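{- For all closed terms $t_0, t_1$ of $\lambda_S$: $t_0 \cong t_1$ if and only if, for every closed context $C$, the term $C[t_0]$ evaluates to some normal form (i.e. $C[t_0] \to^* t'$ for some normal form $t'$) exactly when $C[t_1]$ evaluates to some normal form.
   Context: The calculus $\lambda_S$ (call-by-value $\lambda$-calculus with shift and reset). Terms and values: $t ::= v \mid t\,t \mid \mathcal{S}k.t \mid \langle t\rangle$, $v ::= x \mid \lambda x.t$ ($\lambda x$ binds $x$, $\mathcal{S}k$ binds $k$; terms are taken up to $\alpha$-conversion). Pure contexts $E ::= \square \mid v\,E \mid E\,t$; evaluation contexts $F ::= \square \mid v\,F \mid F\,t \mid \langle F\rangle$; contexts $C ::= \square \mid \lambda x.C \mid t\,C \mid C\,t \mid \mathcal{S}k.C \mid \langle C\rangle$ (plugging may capture variables). Reduction $\to$ is given by: $F[(\lambda x.t)\,v] \to F[t\{v/x\}]$; $F[\langle E[\mathcal{S}k.t]\rangle] \to F[\langle t\{\lambda x.\langle E[x]\rangle/k\}\rangle]$ with $x\notin \mathrm{fv}(E)$; $F[\langle v\rangle]\to F[v]$. A term is stuck if it is not a value and does not reduce; a control-stuck term is one of the form $E[\mathcal{S}k.t]$. A normal form is a value or a stuck term. $t \Downarrow t'$ means $t\to^* t'$ and $t'$ is a normal form. Contextual equivalence on closed terms: $t_0 \cong t_1$ iff for every closed context $C$, (a) $C[t_0]\Downarrow v_0$ for some value $v_0$ iff $C[t_1]\Downarrow v_1$ for some value $v_1$, and (b) $C[t_0]\Downarrow t_0'$ for some control-stuck term $t_0'$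 iff $C[t_1]\Downarrow t_1'$ for some control-stuck term $t_1'$. -}

module Defs where

open import Data.Nat using (ℕ; zero; suc)
open import Data.Fin using (Fin; zero; suc)
open import Data.Product using (Σ; Σ-syntax; _×_; _,_)
open import Data.Sum using (_⊎_)
open import Relation.Nullary using (¬_)
open import Relation.Binary.PropositionalEquality using (_≡_)
open import Relation.Binary.Construct.Closure.ReflexiveTransitive using (Star)
open import Function.Bundles using (_⇔_)

-- Terms of λ_S, well-scoped de Bruijn syntax (α-conversion is built in).
-- Tm n = terms whose free variables are among n de Bruijn indices.

data Tm (n : ℕ) : Set where
  var   : Fin n → Tm n
  lam   : Tm (suc n) → Tm n
  app   : Tm n → Tm n → Tm n
  shift : Tm (suc n) → Tm n
  reset : Tm n → Tm n

data Val (n : ℕ) : Set where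
  vvar : Fin n → Val n
  vlam : Tm (suc n) → Val n

⌜_⌝ : ∀ {n} → Val n → Tm n
⌜ vvar x ⌝ = var x
⌜ vlam t ⌝ = lam t

IsVal : ∀ {n} → Tm n → Set
IsVal {n} t = Σ[ v ∈ Val n ] ⌜ v ⌝ ≡ t

Ren : ℕ → ℕ → Set
Ren m n = Fin m → Fin n

extR : ∀ {m n} → Ren m n → Ren (suc m) (suc n)
extR ρ zero    = zero
extR ρ (suc x) = suc (ρ x)

ren : ∀ {m n} → Ren m n → Tm m → Tm n
ren ρ (var x)     = var (ρ x)
ren ρ (lam t)     = lam (ren (extR ρ) t)
ren ρ (app t u)   = app (ren ρ t) (ren ρ u)
ren ρ (shift t)   = shift (ren (extR ρ) t)
ren ρ (reset t)   = reset (ren ρ t)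

Sub : ℕ → ℕ → Set
Sub m n = Fin m → Tm n

extS : ∀ {m n} → Sub m n → Sub (suc m) (suc n)
extS σ zero    = var zero
extS σ (suc x) = ren suc (σ x)

sub : ∀ {m n} → Sub m n → Tm m → Tm n
sub σ (var x)     = σ x
sub σ (lam t)     = lam (sub (extS σ) t)
sub σ (app t u)   = app (sub σ t) (sub σ u)
sub σ (shift t)   = shift (sub (extS σ) t)
sub σ (reset t)   = reset (sub σ t)

_[_] : ∀ {n} → Tm (suc n) → Tm n → Tm n
t [ u ] = sub σ t
  where
  σ : Sub _ _
  σ zero    = u
  σ (suc x) = var x

renV : ∀ {m n} → Ren m n → Val m → Val n
renV ρ (vvar x) = vvar (ρ x)
renV ρ (vlam t) = vlam (ren (extR ρ) t)

data ECtx (n : ℕ) : Set where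
  hole : ECtx n
  valE : Val n → ECtx n → ECtx n
  appE : ECtx n → Tm n → ECtx n

plugE : ∀ {n} → ECtx n → Tm n → Tm n
plugE hole       s = s
plugE (valE v E) s = app ⌜ v ⌝ (plugE E s)
plugE (appE E t) s = app (plugE E s) t

renE : ∀ {m n} → Ren m n → ECtx m → ECtx n
renE ρ hole       = hole
renE ρ (valE v E) = valE (renV ρ v) (renE ρ E)
renE ρ (appE E t) = appE (renE ρ E) (ren ρ t)

data FCtx (n : ℕ) : Set where
  hole   : FCtx n
  valF   : Val n → FCtx n → FCtx n
  appF   : FCtx n → Tm n → FCtx n
  resetF : FCtx n → FCtx n

plugF : ∀ {n} → FCtx n → Tm n → Tm n
plugF hole       s = s
plugF (valF v F) s = app ⌜ v ⌝ (plugF F s)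
plugF (appF F t) s = app (plugF F s) t
plugF (resetF F) s = reset (plugF F s)

-- λx.⟨E[x]⟩ with x fresh for E (x = index 0, E weakened)
contK : ∀ {n} → ECtx n → Tm n
contK E = lam (reset (plugE (renE suc E) (var zero)))

data _⟶_ {n : ℕ} : Tm n → Tm n → Set where
  βv    : (F : FCtx n) (t : Tm (suc n)) (v : Val n) →
          plugF F (app (lam t) ⌜ v ⌝) ⟶ plugF F (t [ ⌜ v ⌝ ])
  shiftR : (F : FCtx n) (E : ECtx n) (t : Tm (suc n)) →
          plugF F (reset (plugE E (shift t))) ⟶ plugF F (reset (t [ contK E ]))
  resetR : (F : FCtx n) (v : Val n) →
          plugF F (reset ⌜ v ⌝) ⟶ plugF F ⌜ v ⌝

_⟶*_ : ∀ {n} → Tm n → Tm n → Set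
_⟶*_ = Star _⟶_

Stuck : ∀ {n} → Tm n → Set
Stuck t = ¬ IsVal t × (∀ t' → ¬ (t ⟶ t'))

ControlStuck : ∀ {n} → Tm n → Set
ControlStuck {n} t = Σ[ E ∈ ECtx n ] Σ[ s ∈ Tm (suc n) ] t ≡ plugE E (shift s)

NormalForm : ∀ {n} → Tm n → Set
NormalForm t = IsVal t ⊎ Stuck t

_⇓_ : ∀ {n} → Tm n → Tm n → Set
t ⇓ t' = (t ⟶* t') × NormalForm t'

-- Contexts C ::= □ | λx.C | t C | C t | 𝒮k.C | ⟨C⟩
-- Ctx n: context whose outer scope has n variables; the hole is filled
-- with a closed term (weakened into the scope at the hole; since it is
-- closed, capture is irrelevant).

data Ctx (n : ℕ) : Set where
  hole   : Ctx n
  lamC   : Ctx (suc n) → Ctx n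
  appRC  : Tm n → Ctx n → Ctx n
  appLC  : Ctx n → Tm n → Ctx n
  shiftC : Ctx (suc n) → Ctx n
  resetC : Ctx n → Ctx n

weaken0 : ∀ {n} → Tm 0 → Tm n
weaken0 = ren (λ ())

plug : ∀ {n} → Ctx n → Tm 0 → Tm n
plug hole         s = weaken0 s
plug (lamC C)     s = lam (plug C s)
plug (appRC t C)  s = app t (plug C s)
plug (appLC C t)  s = app (plug C s) t
plug (shiftC C)   s = shift (plug C s)
plug (resetC C)   s = reset (plug C s)

_≅_ : Tm 0 → Tm 0 → Set
t₀ ≅ t₁ = ∀ (C : Ctx 0) →
  ((Σ[ v₀ ∈ Tm 0 ] (plug C t₀ ⇓ v₀ × IsVal v₀)) ⇔
   (Σ[ v₁ ∈ Tm 0 ] (plug C t₁ ⇓ v₁ × IsVal v₁)))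
  ×
  ((Σ[ s₀ ∈ Tm 0 ] (plug C t₀ ⇓ s₀ × ControlStuck s₀)) ⇔
   (Σ[ s₁ ∈ Tm 0 ] (plug C t₁ ⇓ s₁ × ControlStuck s₁)))

-- Reduction is deterministic, and a closed term that is stuck is control-stuck
-- (progress), so a closed term terminates exactly when it reaches a value or a
-- control-stuck term; hence contextual equivalence implies equi-termination.
-- Conversely, the context (λx.Ω) C tells the two kinds of normal form apart:
-- if C[t] reaches a value then (λx.Ω) C[t] diverges, and if C[t] reaches
-- E[𝒮k.s] then (λx.Ω) C[t] reaches the control-stuck term (λx.Ω) E[𝒮k.s].
-- Equi-termination under C and under (λx.Ω) C therefore separates the cases.
module Submission where

open import Defs
open import Data.Nat using (ℕ; suc)
open import Data.Fin using (Fin; zero)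
open import Data.Product using (Σ-syntax; _×_; _,_; proj₁; proj₂)
open import Data.Sum using (_⊎_; inj₁; inj₂)
open import Data.Empty using (⊥-elim)
open import Relation.Nullary using (¬_)
open import Relation.Binary.PropositionalEquality using (_≡_; refl; sym; trans; cong; subst; subst₂)
open import Relation.Binary.Construct.Closure.ReflexiveTransitive using (ε; _◅_; _◅◅_; gmap)
open import Function.Bundles using (_⇔_; mk⇔; Equivalence)
open Equivalence using (to; from)

private variable
  n : ℕ
  a b c d : Tm n
  s₀ s₁ : Tm 0

data IsValue {n : ℕ} : Tm n → Set where
  var : (x : Fin n) → IsValue (var x)
  lam : (t : Tm (suc n)) → IsValue (lam t)

⌜⌝-isValue : (v : Val n) → IsValue ⌜ v ⌝
⌜⌝-isValue (vvar x) = var x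
⌜⌝-isValue (vlam t) = lam t

⌜⌝-injective : (v w : Val n) → ⌜ v ⌝ ≡ ⌜ w ⌝ → v ≡ w
⌜⌝-injective (vvar x) (vvar .x) refl = refl
⌜⌝-injective (vlam t) (vlam .t) refl = refl

app-injective : app a b ≡ app c d → a ≡ c × b ≡ d
app-injective refl = refl , refl

-- A syntax-directed presentation of ⟶, on which determinism is proved by
-- matching on both steps; shift-reset takes its redex through an equation so
-- that matching never has to unify a term with plugE.
infix 4 _↦_

data _↦_ {n : ℕ} : Tm n → Tm n → Set where
  β           : {t : Tm (suc n)} → IsValue b → app (lam t) b ↦ t [ b ]
  shift-reset : (E : ECtx n) (t : Tm (suc n)) → b ≡ plugE E (shift t) →
                reset b ↦ reset (t [ contK E ])
  reset-value : IsValue b → reset b ↦ b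
  app-left    : a ↦ b → app a c ↦ app b c
  app-right   : IsValue a → b ↦ c → app a b ↦ app a c
  reset-cong  : a ↦ b → reset a ↦ reset b

↦-congF : (F : FCtx n) → a ↦ b → plugF F a ↦ plugF F b
↦-congF hole       r = r
↦-congF (valF v F) r = app-right (⌜⌝-isValue v) (↦-congF F r)
↦-congF (appF F t) r = app-left (↦-congF F r)
↦-congF (resetF F) r = reset-cong (↦-congF F r)

⟶⇒↦ : a ⟶ b → a ↦ b
⟶⇒↦ (βv F t v)     = ↦-congF F (β (⌜⌝-isValue v))
⟶⇒↦ (shiftR F E t) = ↦-congF F (shift-reset E t refl)
⟶⇒↦ (resetR F v)   = ↦-congF F (reset-value (⌜⌝-isValue v))

value-irreducible : IsValue a → ¬ (a ↦ b)
value-irreducible (var x) ()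
value-irreducible (lam t) ()

controlStuck-not-value : (E : ECtx n) (t : Tm (suc n)) → ¬ IsValue (plugE E (shift t))
controlStuck-not-value hole       t ()
controlStuck-not-value (valE v E) t ()
controlStuck-not-value (appE E u) t ()

controlStuck-irreducible : (E : ECtx n) (t : Tm (suc n)) → ¬ (plugE E (shift t) ↦ b)
controlStuck-irreducible hole                  t ()
controlStuck-irreducible (valE (vvar x) E)     t (app-right _ r) = controlStuck-irreducible E t r
controlStuck-irreducible (valE (vlam w) E)     t (β v)           = controlStuck-not-value E t v
controlStuck-irreducible (valE (vlam w) E)     t (app-right _ r) = controlStuck-irreducible E t r
controlStuck-irreducible (appE hole u)         t (app-left ())
controlStuck-irreducible (appE E@(valE _ _) u) t (app-left r)    = controlStuck-irreducible E t r
controlStuck-irreducible (appE E@(appE _ _) u) t (app-left r)    = controlStuck-irreducible E t r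
controlStuck-irreducible (appE E u)            t (app-right v r) = controlStuck-not-value E t v

plugE-shift-injective : (E E′ : ECtx n) (t t′ : Tm (suc n)) →
  plugE E (shift t) ≡ plugE E′ (shift t′) → E ≡ E′ × t ≡ t′
plugE-shift-injective hole        hole         t t′ refl = refl , refl
plugE-shift-injective (valE v E)  (valE w E′)  t t′ eq
  with refl     ← ⌜⌝-injective v w (proj₁ (app-injective eq))
     | refl , refl ← plugE-shift-injective E E′ t t′ (proj₂ (app-injective eq)) = refl , refl
plugE-shift-injective (valE v E)  (appE E′ u′) t t′ eq =
  ⊥-elim (controlStuck-not-value E′ t′ (subst IsValue (proj₁ (app-injective eq)) (⌜⌝-isValue v)))
plugE-shift-injective (appE E u)  (valE w E′)  t t′ eq =
  ⊥-elim (controlStuck-not-value E t (subst IsValue (sym (proj₁ (app-injective eq))) (⌜⌝-isValue w)))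
plugE-shift-injective (appE E u)  (appE E′ u′) t t′ eq
  with refl , refl ← plugE-shift-injective E E′ t t′ (proj₁ (app-injective eq))
     | refl        ← proj₂ (app-injective eq) = refl , refl

↦-deterministic : a ↦ b → a ↦ c → b ≡ c
↦-deterministic (β _)           (β _)            = refl
↦-deterministic (β v)           (app-right _ r)  = ⊥-elim (value-irreducible v r)
↦-deterministic (shift-reset E t eq) (shift-reset E′ t′ eq′)
  with refl , refl ← plugE-shift-injective E E′ t t′ (trans (sym eq) eq′) = refl
↦-deterministic (shift-reset E t refl) (reset-value v) = ⊥-elim (controlStuck-not-value E t v)
↦-deterministic (shift-reset E t refl) (reset-cong r)  = ⊥-elim (controlStuck-irreducible E t r)
↦-deterministic (reset-value v) (shift-reset E t refl) = ⊥-elim (controlStuck-not-value E t v)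
↦-deterministic (reset-value _) (reset-value _)  = refl
↦-deterministic (reset-value v) (reset-cong r)   = ⊥-elim (value-irreducible v r)
↦-deterministic (app-left r)    (app-left r′)    = cong (λ x → app x _) (↦-deterministic r r′)
↦-deterministic (app-left r)    (app-right v _)  = ⊥-elim (value-irreducible v r)
↦-deterministic (app-right _ r) (β v)            = ⊥-elim (value-irreducible v r)
↦-deterministic (app-right v _) (app-left r)     = ⊥-elim (value-irreducible v r)
↦-deterministic (app-right _ r) (app-right _ r′) = cong (app _) (↦-deterministic r r′)
↦-deterministic (reset-cong r)  (shift-reset E t refl) = ⊥-elim (controlStuck-irreducible E t r)
↦-deterministic (reset-cong r)  (reset-value v)  = ⊥-elim (value-irreducible v r)
↦-deterministic (reset-cong r)  (reset-cong r′)  = cong reset (↦-deterministic r r′)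

⟶-deterministic : a ⟶ b → a ⟶ c → b ≡ c
⟶-deterministic r r′ = ↦-deterministic (⟶⇒↦ r) (⟶⇒↦ r′)

normalForm-irreducible : NormalForm a → ¬ (a ⟶ b)
normalForm-irreducible (inj₁ (v , refl)) r = value-irreducible (⌜⌝-isValue v) (⟶⇒↦ r)
normalForm-irreducible (inj₂ (_ , irr))  r = irr _ r

reduct-reaches-normalForm : a ⟶* c → NormalForm c → a ⟶* b → b ⟶* c
reduct-reaches-normalForm rs       nf ε          = rs
reduct-reaches-normalForm ε        nf (r ◅ _)    = ⊥-elim (normalForm-irreducible nf r)
reduct-reaches-normalForm (r ◅ rs) nf (r′ ◅ rs′)
  with refl ← ⟶-deterministic r r′ = reduct-reaches-normalForm rs nf rs′

controlStuck-normalForm : (E : ECtx n) (t : Tm (suc n)) → NormalForm (plugE E (shift t))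
controlStuck-normalForm E t = inj₂
  ( (λ (v , eq) → controlStuck-not-value E t (subst IsValue eq (⌜⌝-isValue v)))
  , (λ _ r → controlStuck-irreducible E t (⟶⇒↦ r)) )

_∘F_ : FCtx n → FCtx n → FCtx n
hole     ∘F G = G
valF v F ∘F G = valF v (F ∘F G)
appF F t ∘F G = appF (F ∘F G) t
resetF F ∘F G = resetF (F ∘F G)

plugF-∘F : (F G : FCtx n) (t : Tm n) → plugF (F ∘F G) t ≡ plugF F (plugF G t)
plugF-∘F hole       G t = refl
plugF-∘F (valF v F) G t = cong (app ⌜ v ⌝) (plugF-∘F F G t)
plugF-∘F (appF F u) G t = cong (λ x → app x u) (plugF-∘F F G t)
plugF-∘F (resetF F) G t = cong reset (plugF-∘F F G t)

⟶-congF : (F : FCtx n) → a ⟶ b → plugF F a ⟶ plugF F b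
⟶-congF F (βv G t v)     = subst₂ _⟶_ (plugF-∘F F G _) (plugF-∘F F G _) (βv (F ∘F G) t v)
⟶-congF F (shiftR G E t) = subst₂ _⟶_ (plugF-∘F F G _) (plugF-∘F F G _) (shiftR (F ∘F G) E t)
⟶-congF F (resetR G v)   = subst₂ _⟶_ (plugF-∘F F G _) (plugF-∘F F G _) (resetR (F ∘F G) v)

⟶*-congF : (F : FCtx n) → a ⟶* b → plugF F a ⟶* plugF F b
⟶*-congF F = gmap (plugF F) (⟶-congF F)

closed-progress : (t : Tm 0) → IsVal t ⊎ (Σ[ t′ ∈ Tm 0 ] (t ⟶ t′)) ⊎ ControlStuck t
closed-progress (lam t)   = inj₁ (vlam t , refl)
closed-progress (shift t) = inj₂ (inj₂ (hole , t , refl))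
closed-progress (reset t) with closed-progress t
... | inj₁ (v , refl)            = inj₂ (inj₁ (_ , resetR hole v))
... | inj₂ (inj₁ (_ , r))        = inj₂ (inj₁ (_ , ⟶-congF (resetF hole) r))
... | inj₂ (inj₂ (E , s , refl)) = inj₂ (inj₁ (_ , shiftR hole E s))
closed-progress (app t u) with closed-progress t
... | inj₂ (inj₁ (_ , r))        = inj₂ (inj₁ (_ , ⟶-congF (appF hole u) r))
... | inj₂ (inj₂ (E , s , refl)) = inj₂ (inj₂ (appE E u , s , refl))
... | inj₁ (vlam w , refl) with closed-progress u
...   | inj₁ (v , refl)            = inj₂ (inj₁ (_ , βv hole w v))
...   | inj₂ (inj₁ (_ , r))        = inj₂ (inj₁ (_ , ⟶-congF (valF (vlam w) hole) r))
...   | inj₂ (inj₂ (E , s , refl)) = inj₂ (inj₂ (valE (vlam w) E , s , refl))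

closed-stuck⇒controlStuck : (t : Tm 0) → Stuck t → ControlStuck t
closed-stuck⇒controlStuck t (not-value , irreducible) with closed-progress t
... | inj₁ isVal           = ⊥-elim (not-value isVal)
... | inj₂ (inj₁ (_ , r))  = ⊥-elim (irreducible _ r)
... | inj₂ (inj₂ stuck)    = stuck

selfApply : Tm (suc n)
selfApply = app (var zero) (var zero)

Ω : Tm n
Ω = app (lam selfApply) (lam selfApply)

Ω-diverges : Ω ⟶* a → ¬ NormalForm a
Ω-diverges ε        nf = normalForm-irreducible nf (βv hole selfApply (vlam selfApply))
Ω-diverges (r ◅ rs) nf
  with refl ← ⟶-deterministic r (βv hole selfApply (vlam selfApply)) = Ω-diverges rs nf

Terminates : Tm n → Set
Terminates {n} t = Σ[ t′ ∈ Tm n ] (t ⇓ t′)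

ReachesValue : Tm n → Set
ReachesValue {n} t = Σ[ v ∈ Tm n ] (t ⇓ v × IsVal v)

ReachesControlStuck : Tm n → Set
ReachesControlStuck {n} t = Σ[ s ∈ Tm n ] (t ⇓ s × ControlStuck s)

closed-terminates : Terminates s₀ → ReachesValue s₀ ⊎ ReachesControlStuck s₀
closed-terminates (t′ , rs , inj₁ isVal) = inj₁ (t′ , (rs , inj₁ isVal) , isVal)
closed-terminates (t′ , rs , inj₂ stuck) =
  inj₂ (t′ , (rs , inj₂ stuck) , closed-stuck⇒controlStuck t′ stuck)

loopOnValue : Tm n → Tm n
loopOnValue = app (lam Ω)

loopOnValueC : Ctx n → Ctx n
loopOnValueC = appRC (lam Ω)

reachesValue⇒loopOnValue-diverges : ReachesValue a → ¬ Terminates (loopOnValue a)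
reachesValue⇒loopOnValue-diverges (_ , (rs , _) , v , refl) (_ , rs′ , nf) =
  Ω-diverges (reduct-reaches-normalForm rs′ nf
               (⟶*-congF (valF (vlam Ω) hole) rs ◅◅ βv hole Ω v ◅ ε)) nf

reachesControlStuck⇒loopOnValue-terminates : ReachesControlStuck a → Terminates (loopOnValue a)
reachesControlStuck⇒loopOnValue-terminates (_ , (rs , _) , E , t , refl) =
  _ , ⟶*-congF (valF (vlam Ω) hole) rs , controlStuck-normalForm (valE (vlam Ω) E) t

terminates-transfer : (ReachesValue s₀ → ReachesValue s₁) →
  (ReachesControlStuck s₀ → ReachesControlStuck s₁) → Terminates s₀ → Terminates s₁
terminates-transfer f g h with closed-terminates h
... | inj₁ val = let (t′ , ev , _) = f val in t′ , ev
... | inj₂ cs  = let (t′ , ev , _) = g cs  in t′ , ev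

reachesValue-transfer : (Terminates s₀ → Terminates s₁) →
  (Terminates (loopOnValue s₁) → Terminates (loopOnValue s₀)) → ReachesValue s₀ → ReachesValue s₁
reachesValue-transfer f g val@(t′ , ev , _) with closed-terminates (f (t′ , ev))
... | inj₁ val₁ = val₁
... | inj₂ cs₁  = ⊥-elim (reachesValue⇒loopOnValue-diverges val
                           (g (reachesControlStuck⇒loopOnValue-terminates cs₁)))

reachesControlStuck-transfer : (Terminates s₀ → Terminates s₁) →
  (Terminates (loopOnValue s₀) → Terminates (loopOnValue s₁)) →
  ReachesControlStuck s₀ → ReachesControlStuck s₁
reachesControlStuck-transfer f g cs@(t′ , ev , _) with closed-terminates (f (t′ , ev))
... | inj₂ cs₁  = cs₁
... | inj₁ val₁ = ⊥-elim (reachesValue⇒loopOnValue-diverges val₁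
                           (g (reachesControlStuck⇒loopOnValue-terminates cs)))

proposition3p3 : (t₀ t₁ : Tm 0) →
    (t₀ ≅ t₁) ⇔ (∀ (C : Ctx 0) → (Σ[ t₀' ∈ Tm 0 ] (plug C t₀ ⇓ t₀')) ⇔ (Σ[ t₁' ∈ Tm 0 ] (plug C t₁ ⇓ t₁')))
proposition3p3 t₀ t₁ = mk⇔ equiTerminating contextuallyEquivalent
  where
  equiTerminating : t₀ ≅ t₁ → ∀ C → Terminates (plug C t₀) ⇔ Terminates (plug C t₁)
  equiTerminating t₀≅t₁ C =
    let (val , cs) = t₀≅t₁ C
    in mk⇔ (terminates-transfer (to val) (to cs)) (terminates-transfer (from val) (from cs))

  contextuallyEquivalent : (∀ C → Terminates (plug C t₀) ⇔ Terminates (plug C t₁)) → t₀ ≅ t₁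
  contextuallyEquivalent H C =
    let H′ = H (loopOnValueC C)
    in mk⇔ (reachesValue-transfer (to (H C)) (from H′))
           (reachesValue-transfer (from (H C)) (to H′))
     , mk⇔ (reachesControlStuck-transfer (to (H C)) (to H′))
           (reachesControlStuck-transfer (from (H C)) (from H′))
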